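{- Let $\mathfrak A$ be a structure. Every positive Horn sentence true in $\mathfrak A$, and every $\forall\exists$-sentence true in all finite powers $\mathfrak A^k$ ($k\ge1$) of $\mathfrak A$, is true in $\mathfrak A^{\mathrm{per}}$.
   Context: Structures are in a countable first-order language (relation, constant, function symbols allowed; equality and $\bot$ included). A positive Horn sentence is built from atomic formulas using only $\wedge,\exists,\forall$. A $\forall\exists$-sentence has the form $\forall\bar x\exists\bar y\,\psi$ with $\psi$ quantifier-free. A function $\vec a:\mathbb N\to A$ is periodic if for some $k\ge1$, $\vec a(i)=\vec a(i\bmod k)$ for all $i$; the periodic power $\mathfrak A^{\mathrm{per}}$ is the substructure of the direct power $\mathfrak A^{\mathbb N}$ on the periodic functions. -}

module Defs where

open import Data.Nat using (ℕ; zero; suc; _+_; _*_; _≤_; _%_; _/_; NonZero; _≡ᵇ_)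
open import Data.Nat.Properties using (*-assoc; *-comm)
open import Data.Nat.DivMod using (m≡m%n+[m/n]*n; %-remove-+ʳ)
open import Data.Nat.Divisibility using (_∣_; ∣-trans; n∣m*n; m∣m*n; ∣-refl)
open import Data.Fin using (Fin)
open import Data.Vec using (Vec; []; _∷_; map)
open import Data.Vec.Relation.Binary.Pointwise.Inductive using (Pointwise)
open import Data.List using (List; []; _∷_)
open import Data.List.Membership.Propositional using (_∈_)
open import Data.Product using (Σ; _×_; _,_; proj₁; proj₂)
open import Data.Sum using (_⊎_)
open import Data.Empty using (⊥)
open import Data.Unit using (⊤)
open import Data.Bool using (if_then_else_)
open import Function.Definitions using (Injective)
open import Relation.Binary.Core using (Rel)
open import Agda.Primitive using (lzero)
open import Relation.Binary.Structures using (IsEquivalence)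
open import Relation.Binary.PropositionalEquality using (_≡_; refl; cong; sym; trans; subst)

-- Languages: relation and function symbols (constants = 0-ary function
-- symbols) with arities; the language is countable, witnessed by
-- injections of the symbol sets into ℕ.

record Language : Set₁ where
  field
    RelSym   : Set
    FunSym   : Set
    relArity : RelSym → ℕ
    funArity : FunSym → ℕ
    relCode  : RelSym → ℕ
    relCodeInjective : Injective _≡_ _≡_ relCode
    funCode  : FunSym → ℕ
    funCodeInjective : Injective _≡_ _≡_ funCode

module Syntax (L : Language) where
  open Language L

  data Term : Set where
    var : ℕ → Term
    app : (f : FunSym) → Vec Term (funArity f) → Term

  data Formula : Set where
    ⊥′   : Formula
    ⊤′   : Formula
    rel  : (R : RelSym) → Vec Term (relArity R) → Formula
    _≐_  : Term → Term → Formula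
    ¬′_  : Formula → Formula
    _∧′_ : Formula → Formula → Formula
    _∨′_ : Formula → Formula → Formula
    _⇒′_ : Formula → Formula → Formula
    ∀′   : ℕ → Formula → Formula
    ∃′   : ℕ → Formula → Formula

  mutual
    TermIn : List ℕ → Term → Set
    TermIn Γ (var x)    = x ∈ Γ
    TermIn Γ (app f ts) = TermsIn Γ ts

    TermsIn : ∀ {n} → List ℕ → Vec Term n → Set
    TermsIn Γ []       = ⊤
    TermsIn Γ (t ∷ ts) = TermIn Γ t × TermsIn Γ ts

  Scoped : List ℕ → Formula → Set
  Scoped Γ ⊥′        = ⊤
  Scoped Γ ⊤′        = ⊤
  Scoped Γ (rel R ts) = TermsIn Γ ts
  Scoped Γ (s ≐ t)   = TermIn Γ s × TermIn Γ t
  Scoped Γ (¬′ φ)    = Scoped Γ φ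
  Scoped Γ (φ ∧′ ψ)  = Scoped Γ φ × Scoped Γ ψ
  Scoped Γ (φ ∨′ ψ)  = Scoped Γ φ × Scoped Γ ψ
  Scoped Γ (φ ⇒′ ψ)  = Scoped Γ φ × Scoped Γ ψ
  Scoped Γ (∀′ x φ)  = Scoped (x ∷ Γ) φ
  Scoped Γ (∃′ x φ)  = Scoped (x ∷ Γ) φ

  Sentence : Formula → Set
  Sentence = Scoped []

  data Atomic : Formula → Set where
    at-⊥   : Atomic ⊥′
    at-rel : ∀ R ts → Atomic (rel R ts)
    at-eq  : ∀ s t → Atomic (s ≐ t)

  data PositiveHorn : Formula → Set where
    ph-atomic : ∀ {φ} → Atomic φ → PositiveHorn φ
    ph-∧ : ∀ {φ ψ} → PositiveHorn φ → PositiveHorn ψ → PositiveHorn (φ ∧′ ψ)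
    ph-∃ : ∀ {x φ} → PositiveHorn φ → PositiveHorn (∃′ x φ)
    ph-∀ : ∀ {x φ} → PositiveHorn φ → PositiveHorn (∀′ x φ)

  data QuantifierFree : Formula → Set where
    qf-⊥   : QuantifierFree ⊥′
    qf-⊤   : QuantifierFree ⊤′
    qf-rel : ∀ R ts → QuantifierFree (rel R ts)
    qf-eq  : ∀ s t → QuantifierFree (s ≐ t)
    qf-¬   : ∀ {φ} → QuantifierFree φ → QuantifierFree (¬′ φ)
    qf-∧   : ∀ {φ ψ} → QuantifierFree φ → QuantifierFree ψ → QuantifierFree (φ ∧′ ψ)
    qf-∨   : ∀ {φ ψ} → QuantifierFree φ → QuantifierFree ψ → QuantifierFree (φ ∨′ ψ)
    qf-⇒   : ∀ {φ ψ} → QuantifierFree φ → QuantifierFree ψ → QuantifierFree (φ ⇒′ ψ)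

  data ExistsQF : Formula → Set where
    eqf-qf : ∀ {φ} → QuantifierFree φ → ExistsQF φ
    eqf-∃  : ∀ {y φ} → ExistsQF φ → ExistsQF (∃′ y φ)

  data ForallExists : Formula → Set where
    fe-∃ : ∀ {φ} → ExistsQF φ → ForallExists φ
    fe-∀ : ∀ {x φ} → ForallExists φ → ForallExists (∀′ x φ)

-- Structures.  The carrier comes with an equivalence _≈_ which is the
-- interpretation of the equality symbol; all symbols respect it.
-- Domains are nonempty (an element is provided).

record Structure (L : Language) : Set₁ where
  open Language L
  field
    Carrier  : Set
    _≈_      : Rel Carrier lzero
    isEquiv  : IsEquivalence _≈_
    element  : Carrier
    relI     : (R : RelSym) → Vec Carrier (relArity R) → Set
    funI     : (f : FunSym) → Vec Carrier (funArity f) → Carrier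
    relI-cong : ∀ R {xs ys} → Pointwise _≈_ xs ys → relI R xs → relI R ys
    funI-cong : ∀ f {xs ys} → Pointwise _≈_ xs ys → funI f xs ≈ funI f ys

module Semantics {L : Language} (𝔄 : Structure L) where
  open Language L
  open Syntax L
  open Structure 𝔄

  Env : Set
  Env = ℕ → Carrier

  _[_↦_] : Env → ℕ → Carrier → Env
  (ρ [ x ↦ a ]) y = if y ≡ᵇ x then a else ρ y

  mutual
    evalT : Env → Term → Carrier
    evalT ρ (var x)    = ρ x
    evalT ρ (app f ts) = funI f (evalTs ρ ts)

    evalTs : ∀ {n} → Env → Vec Term n → Vec Carrier n
    evalTs ρ []       = []
    evalTs ρ (t ∷ ts) = evalT ρ t ∷ evalTs ρ ts

  Sat : Env → Formula → Set
  Sat ρ ⊥′         = ⊥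
  Sat ρ ⊤′         = ⊤
  Sat ρ (rel R ts) = relI R (evalTs ρ ts)
  Sat ρ (s ≐ t)    = evalT ρ s ≈ evalT ρ t
  Sat ρ (¬′ φ)     = Sat ρ φ → ⊥
  Sat ρ (φ ∧′ ψ)   = Sat ρ φ × Sat ρ ψ
  Sat ρ (φ ∨′ ψ)   = Sat ρ φ ⊎ Sat ρ ψ
  Sat ρ (φ ⇒′ ψ)   = Sat ρ φ → Sat ρ ψ
  Sat ρ (∀′ x φ)   = (a : Carrier) → Sat (ρ [ x ↦ a ]) φ
  Sat ρ (∃′ x φ)   = Σ Carrier λ a → Sat (ρ [ x ↦ a ]) φ

-- truth of a sentence (free variables are irrelevant; we evaluate in the
-- constant environment)
_⊨_ : {L : Language} → (𝔄 : Structure L) → Syntax.Formula L → Set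
𝔄 ⊨ φ = Semantics.Sat 𝔄 (λ _ → Structure.element 𝔄) φ

pointwiseVec : ∀ {A I : Set} {n} → Vec (I → A) n → I → Vec A n
pointwiseVec xs i = map (λ f → f i) xs

private
  pw-lemma : ∀ {A I : Set} {_≈_ : Rel A lzero} {n} {xs ys : Vec (I → A) n} →
             Pointwise (λ f g → ∀ i → f i ≈ g i) xs ys → ∀ i →
             Pointwise _≈_ (pointwiseVec xs i) (pointwiseVec ys i)
  pw-lemma Pointwise.[] i = Pointwise.[]
  pw-lemma (p Pointwise.∷ ps) i = p i Pointwise.∷ pw-lemma ps i

power : {L : Language} → Structure L → Set → Structure L
power {L} 𝔄 I = record
  { Carrier = I → Carrier
  ; _≈_ = λ f g → ∀ i → f i ≈ g i
  ; isEquiv = record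
      { refl = λ i → IsEquivalence.refl isEquiv
      ; sym = λ p i → IsEquivalence.sym isEquiv (p i)
      ; trans = λ p q i → IsEquivalence.trans isEquiv (p i) (q i) }
  ; element = λ _ → element
  ; relI = λ R xs → ∀ i → relI R (pointwiseVec xs i)
  ; funI = λ f xs i → funI f (pointwiseVec xs i)
  ; relI-cong = λ R p r i → relI-cong R (pw-lemma p i) (r i)
  ; funI-cong = λ f p i → funI-cong f (pw-lemma p i)
  }
  where open Structure 𝔄

_^_ : {L : Language} → Structure L → ℕ → Structure L
𝔄 ^ k = power 𝔄 (Fin k)

module _ {L : Language} (𝔄 : Structure L) where
  open Structure 𝔄

  IsPeriodic : (ℕ → Carrier) → Set
  IsPeriodic a = Σ ℕ λ k → Σ (NonZero k) λ nz →
                   ∀ i → a i ≈ a (_%_ i k {{nz}})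

private
  mod-div : ∀ i k m .{{_ : NonZero k}} .{{_ : NonZero m}} → k ∣ m →
            (i % m) % k ≡ i % k
  mod-div i k m k∣m = sym (trans (cong (_% k) (m≡m%n+[m/n]*n i m))
      (%-remove-+ʳ (i % m) (∣-trans k∣m (n∣m*n (i / m)))))

  nz-* : ∀ m n → NonZero m → NonZero n → NonZero (m * n)
  nz-* (suc m) (suc n) _ _ = _

module _ {L : Language} (𝔄 : Structure L) where
  open Structure 𝔄
  open Language L
  private
    module E = IsEquivalence isEquiv

  PerCarrier : Set
  PerCarrier = Σ (ℕ → Carrier) (IsPeriodic 𝔄)

  private
    HasPeriod : (ℕ → Carrier) → (k : ℕ) → NonZero k → Set
    HasPeriod a k nz = ∀ i → a i ≈ a (_%_ i k {{nz}})

    period-mult : ∀ a k nz m nzm → _∣_ k m → HasPeriod a k nz → HasPeriod a m nzm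
    period-mult a k nz m nzm k∣m pa i =
      E.trans (pa i) (E.trans
         (subst (λ z → a (_%_ i k {{nz}}) ≈ a z)
            (sym (mod-div i k m {{nz}} {{nzm}} k∣m)) E.refl)
         (E.sym (pa (_%_ i m {{nzm}}))))

    period : ∀ {n} → Vec PerCarrier n → Σ ℕ NonZero
    period [] = 1 , _
    period ((_ , k , nz , _) ∷ xs) =
      proj₁ (period xs) * k , nz-* (proj₁ (period xs)) k (proj₂ (period xs)) nz

    periodic-at : ∀ {n} (xs : Vec PerCarrier n) m nzm → _∣_ (proj₁ (period xs)) m → ∀ i →
      Pointwise _≈_ (pointwiseVec (map proj₁ xs) i)
                    (pointwiseVec (map proj₁ xs) (_%_ i m {{nzm}}))
    periodic-at [] m nzm d i = Pointwise.[]
    periodic-at ((a , k , nz , pa) ∷ xs) m nzm d i =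
      period-mult a k nz m nzm (∣-trans (n∣m*n (proj₁ (period xs))) d) pa i
      Pointwise.∷ periodic-at xs m nzm (∣-trans (m∣m*n k) d) i

    funPeriodic : ∀ f (xs : Vec PerCarrier (funArity f)) →
                  IsPeriodic 𝔄 (λ i → funI f (pointwiseVec (map proj₁ xs) i))
    funPeriodic f xs = proj₁ (period xs) , proj₂ (period xs) ,
      λ i → funI-cong f (periodic-at xs (proj₁ (period xs)) (proj₂ (period xs)) ∣-refl i)

    pw-proj : ∀ {n} {xs ys : Vec PerCarrier n} →
      Pointwise (λ x y → ∀ i → proj₁ x i ≈ proj₁ y i) xs ys →
      Pointwise (λ f g → ∀ i → f i ≈ g i) (map proj₁ xs) (map proj₁ ys)
    pw-proj Pointwise.[] = Pointwise.[]
    pw-proj (p Pointwise.∷ ps) = p Pointwise.∷ pw-proj ps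

    𝔄ℕ = power 𝔄 ℕ
    module 𝔄ℕ = Structure 𝔄ℕ

  periodicPower : Structure L
  periodicPower = record
    { Carrier = PerCarrier
    ; _≈_ = λ x y → proj₁ x 𝔄ℕ.≈ proj₁ y
    ; isEquiv = record
        { refl = IsEquivalence.refl 𝔄ℕ.isEquiv
        ; sym = IsEquivalence.sym 𝔄ℕ.isEquiv
        ; trans = IsEquivalence.trans 𝔄ℕ.isEquiv }
    ; element = 𝔄ℕ.element , 1 , _ , λ i → E.refl
    ; relI = λ R xs → 𝔄ℕ.relI R (map proj₁ xs)
    ; funI = λ f xs → 𝔄ℕ.funI f (map proj₁ xs) , funPeriodic f xs
    ; relI-cong = λ R p → 𝔄ℕ.relI-cong R (pw-proj p)
    ; funI-cong = λ f p → 𝔄ℕ.funI-cong f (pw-proj p)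
    }

-- An element of 𝔄ᵖᵉʳ with period m is the pullback along j ↦ j mod m of an element of 𝔄ᵐ,
-- and pulling back along a surjection of index sets preserves and reflects quantifier-free
-- formulas. As 𝔄ᵖᵉʳ is a substructure of 𝔄^ℕ, a ∀∃-sentence true in every 𝔄ᵐ holds in 𝔄ᵖᵉʳ:
-- given arguments with common period m, take the existential witnesses in 𝔄ᵐ and extend them
-- periodically. A positive Horn sentence is evaluated coordinatewise instead: a witness is
-- chosen in 𝔄 at each coordinate below a common period m of the parameters and repeated with
-- period m, while a universal quantifier over an element of period k only moves to period m k.
module Submission where

open import Defs
open import Data.Nat using (ℕ; _≤_; _%_; _*_; NonZero; _≡ᵇ_; >-nonZero⁻¹)
open import Data.Nat.Properties using (m*n≢0)
open import Data.Nat.DivMod using (_mod_; m%n<n; m%n%n≡m%n; m<n⇒m%n≡m; m∣n⇒o%n%m≡o%m)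
open import Data.Nat.Divisibility using (_∣_; m∣m*n; n∣m*n)
open import Data.Fin using (Fin; toℕ)
open import Data.Fin.Properties using (toℕ-fromℕ<; fromℕ<-cong; toℕ-injective; toℕ<n)
open import Data.Vec using (Vec; []; _∷_; map)
open import Data.Vec.Relation.Binary.Pointwise.Inductive using (Pointwise; []; _∷_)
open import Data.Product using (_×_; _,_; proj₁; proj₂)
open import Data.Product.Function.NonDependent.Propositional using (_×-⇔_)
open import Data.Sum using (_⊎_; inj₁; inj₂)
open import Data.Sum.Function.Propositional using (_⊎-⇔_)
open import Data.Empty using (⊥)
open import Data.Bool using (true; false; if_then_else_)
open import Data.Bool.Properties using (if-float)
open import Function.Base using (id; _∘_)
open import Function.Bundles using (_⇔_; mk⇔; Equivalence)
open import Function.Properties.Equivalence using (⇔-isEquivalence)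
open import Function.Related.TypeIsomorphisms using (¬-cong-⇔; →-cong-⇔)
open import Relation.Binary.Structures using (IsEquivalence)
open import Relation.Binary.PropositionalEquality using (_≡_; refl; cong; cong₂; sym; trans; subst)

private
  module ⇔ {ℓ} = IsEquivalence (⇔-isEquivalence {ℓ})

∀-reindex-⇔ : ∀ {I J : Set} {P : I → Set} (r : J → I) (s : I → J) →
              (∀ i → r (s i) ≡ i) → (∀ j → P (r j)) ⇔ (∀ i → P i)
∀-reindex-⇔ {P = P} r s r∘s = mk⇔ (λ h i → subst P (r∘s i) (h (s i))) (λ h j → h (r j))

update-∘ : ∀ {A B : Set} (F : A → B) (ρ : ℕ → A) x a y →
           F (if y ≡ᵇ x then a else ρ y) ≡ (if y ≡ᵇ x then F a else F (ρ y))
update-∘ F ρ x a y = if-float F (y ≡ᵇ x)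

module Invariance {L : Language} (𝔅 : Structure L) where
  open Syntax L
  open Structure 𝔅
  open Semantics 𝔅
  private module ≈ = IsEquivalence isEquiv

  _≈ᴱ_ : Env → Env → Set
  ρ ≈ᴱ ρ' = ∀ y → ρ y ≈ ρ' y

  ≡⇒≈ᴱ : ∀ {ρ ρ'} → (∀ y → ρ y ≡ ρ' y) → ρ ≈ᴱ ρ'
  ≡⇒≈ᴱ e y = ≈.reflexive (e y)

  ≈ᴱ-sym : ∀ {ρ ρ'} → ρ ≈ᴱ ρ' → ρ' ≈ᴱ ρ
  ≈ᴱ-sym e y = ≈.sym (e y)

  update-cong : ∀ {ρ ρ'} x a → ρ ≈ᴱ ρ' → (ρ [ x ↦ a ]) ≈ᴱ (ρ' [ x ↦ a ])
  update-cong x a e y with y ≡ᵇ x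
  ... | true  = ≈.refl
  ... | false = e y

  mutual
    evalT-cong : ∀ {ρ ρ'} → ρ ≈ᴱ ρ' → ∀ t → evalT ρ t ≈ evalT ρ' t
    evalT-cong e (var x)    = e x
    evalT-cong e (app f ts) = funI-cong f (evalTs-cong e ts)

    evalTs-cong : ∀ {ρ ρ'} → ρ ≈ᴱ ρ' → ∀ {n} (ts : Vec Term n) →
                  Pointwise _≈_ (evalTs ρ ts) (evalTs ρ' ts)
    evalTs-cong e []       = []
    evalTs-cong e (t ∷ ts) = evalT-cong e t ∷ evalTs-cong e ts

  Sat-cong : ∀ {ρ ρ'} → ρ ≈ᴱ ρ' → ∀ φ → Sat ρ φ → Sat ρ' φ
  Sat-cong e ⊥′         s           = s
  Sat-cong e ⊤′         s           = s
  Sat-cong e (rel R ts) s           = relI-cong R (evalTs-cong e ts) s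
  Sat-cong e (u ≐ t)    s           = ≈.trans (≈.sym (evalT-cong e u)) (≈.trans s (evalT-cong e t))
  Sat-cong e (¬′ φ)     s           = s ∘ Sat-cong (≈ᴱ-sym e) φ
  Sat-cong e (φ ∧′ ψ)   (s , t)     = Sat-cong e φ s , Sat-cong e ψ t
  Sat-cong e (φ ∨′ ψ)   (inj₁ s)    = inj₁ (Sat-cong e φ s)
  Sat-cong e (φ ∨′ ψ)   (inj₂ s)    = inj₂ (Sat-cong e ψ s)
  Sat-cong e (φ ⇒′ ψ)   s           = Sat-cong e ψ ∘ s ∘ Sat-cong (≈ᴱ-sym e) φ
  Sat-cong e (∀′ x φ)   s           = λ a → Sat-cong (update-cong x a e) φ (s a)
  Sat-cong e (∃′ x φ)   (a , s)     = a , Sat-cong (update-cong x a e) φ s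

module Power {L : Language} (𝔄 : Structure L) (I : Set) where
  open Syntax L
  open Structure 𝔄 using (_≈_; relI; funI)
  private
    module S  = Semantics 𝔄
    module Sᴵ = Semantics (power 𝔄 I)

  coordinate : Sᴵ.Env → I → S.Env
  coordinate σ i y = σ y i

  mutual
    evalT-coordinate : ∀ σ i t → Sᴵ.evalT σ t i ≡ S.evalT (coordinate σ i) t
    evalT-coordinate σ i (var x)    = refl
    evalT-coordinate σ i (app f ts) = cong (funI f) (evalTs-coordinate σ i ts)

    evalTs-coordinate : ∀ σ i {n} (ts : Vec Term n) →
                        pointwiseVec (Sᴵ.evalTs σ ts) i ≡ S.evalTs (coordinate σ i) ts
    evalTs-coordinate σ i []       = refl
    evalTs-coordinate σ i (t ∷ ts) = cong₂ _∷_ (evalT-coordinate σ i t) (evalTs-coordinate σ i ts)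

  rel-coordinatewise : ∀ σ R ts → Sᴵ.Sat σ (rel R ts) ⇔ (∀ i → S.Sat (coordinate σ i) (rel R ts))
  rel-coordinatewise σ R ts = mk⇔ (λ h i → subst (relI R) (evalTs-coordinate σ i ts) (h i))
                                  (λ h i → subst (relI R) (sym (evalTs-coordinate σ i ts)) (h i))

  ≐-coordinatewise : ∀ σ u t → Sᴵ.Sat σ (u ≐ t) ⇔ (∀ i → S.Sat (coordinate σ i) (u ≐ t))
  ≐-coordinatewise σ u t = mk⇔ (λ h i → subst id (eq i) (h i)) (λ h i → subst id (sym (eq i)) (h i))
    where
    eq : ∀ i → (Sᴵ.evalT σ u i ≈ Sᴵ.evalT σ t i) ≡ S.Sat (coordinate σ i) (u ≐ t)
    eq i = cong₂ _≈_ (evalT-coordinate σ i u) (evalT-coordinate σ i t)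

module Reindexing {L : Language} (𝔄 : Structure L) {I J : Set}
                  (r : J → I) (s : I → J) (r∘s : ∀ i → r (s i) ≡ i) where
  open Syntax L
  private
    module Sᴵ = Semantics (power 𝔄 I)
    module Sᴶ = Semantics (power 𝔄 J)
    module Pᴵ = Power 𝔄 I
    module Pᴶ = Power 𝔄 J

  pullback : Sᴵ.Env → Sᴶ.Env
  pullback σ y = σ y ∘ r

  pullback-qf : ∀ {φ} → QuantifierFree φ → ∀ σ → Sᴶ.Sat (pullback σ) φ ⇔ Sᴵ.Sat σ φ
  pullback-qf qf-⊥          σ = ⇔.refl
  pullback-qf qf-⊤          σ = ⇔.refl
  pullback-qf (qf-rel R ts) σ =
    ⇔.trans (Pᴶ.rel-coordinatewise (pullback σ) R ts)
      (⇔.trans (∀-reindex-⇔ r s r∘s) (⇔.sym (Pᴵ.rel-coordinatewise σ R ts)))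
  pullback-qf (qf-eq u t)   σ =
    ⇔.trans (Pᴶ.≐-coordinatewise (pullback σ) u t)
      (⇔.trans (∀-reindex-⇔ r s r∘s) (⇔.sym (Pᴵ.≐-coordinatewise σ u t)))
  pullback-qf (qf-¬ p)      σ = ¬-cong-⇔ (pullback-qf p σ)
  pullback-qf (qf-∧ p q)    σ = pullback-qf p σ ×-⇔ pullback-qf q σ
  pullback-qf (qf-∨ p q)    σ = pullback-qf p σ ⊎-⇔ pullback-qf q σ
  pullback-qf (qf-⇒ p q)    σ = →-cong-⇔ (pullback-qf p σ) (pullback-qf q σ)

module PeriodicPower {L : Language} (𝔄 : Structure L) where
  open Syntax L
  open Structure 𝔄
  private
    module ≈ = IsEquivalence isEquiv
    module S  = Semantics 𝔄
    module Sᴾ = Semantics (periodicPower 𝔄)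
    module Sᴺ = Semantics (power 𝔄 ℕ)
    module Sᵐ (m : ℕ) = Semantics (𝔄 ^ m)
    module Iᴬ = Invariance 𝔄
    module Iᴾ = Invariance (periodicPower 𝔄)
    module Iᵐ (m : ℕ) = Invariance (𝔄 ^ m)
    module Pᴺ = Power 𝔄 ℕ

  forget : Sᴾ.Env → Sᴺ.Env
  forget ρ y = proj₁ (ρ y)

  mutual
    evalT-forget : ∀ ρ t → proj₁ (Sᴾ.evalT ρ t) ≡ Sᴺ.evalT (forget ρ) t
    evalT-forget ρ (var x)    = refl
    evalT-forget ρ (app f ts) =
      cong (λ as j → funI f (pointwiseVec as j)) (evalTs-forget ρ ts)

    evalTs-forget : ∀ ρ {n} (ts : Vec Term n) → map proj₁ (Sᴾ.evalTs ρ ts) ≡ Sᴺ.evalTs (forget ρ) ts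
    evalTs-forget ρ []       = refl
    evalTs-forget ρ (t ∷ ts) = cong₂ _∷_ (evalT-forget ρ t) (evalTs-forget ρ ts)

  Sat-forget-qf : ∀ {φ} → QuantifierFree φ → ∀ ρ → Sᴾ.Sat ρ φ ≡ Sᴺ.Sat (forget ρ) φ
  Sat-forget-qf qf-⊥          ρ = refl
  Sat-forget-qf qf-⊤          ρ = refl
  Sat-forget-qf (qf-rel R ts) ρ = cong (Structure.relI (power 𝔄 ℕ) R) (evalTs-forget ρ ts)
  Sat-forget-qf (qf-eq u t)   ρ = cong₂ (Structure._≈_ (power 𝔄 ℕ)) (evalT-forget ρ u) (evalT-forget ρ t)
  Sat-forget-qf (qf-¬ p)      ρ = cong (λ A → A → ⊥) (Sat-forget-qf p ρ)
  Sat-forget-qf (qf-∧ p q)    ρ = cong₂ _×_ (Sat-forget-qf p ρ) (Sat-forget-qf q ρ)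
  Sat-forget-qf (qf-∨ p q)    ρ = cong₂ _⊎_ (Sat-forget-qf p ρ) (Sat-forget-qf q ρ)
  Sat-forget-qf (qf-⇒ p q)    ρ = cong₂ (λ A B → A → B) (Sat-forget-qf p ρ) (Sat-forget-qf q ρ)

  HasPeriod : (ℕ → Carrier) → (m : ℕ) → .{{NonZero m}} → Set
  HasPeriod a m = ∀ j → a j ≈ a (j % m)

  hasPeriod-∣ : ∀ {a} m k .{{_ : NonZero m}} .{{_ : NonZero k}} → m ∣ k → HasPeriod a m → HasPeriod a k
  hasPeriod-∣ {a} m k m∣k per j =
    ≈.trans (per j) (≈.trans (≈.reflexive (cong a (sym (m∣n⇒o%n%m≡o%m m k j m∣k)))) (≈.sym (per (j % k))))

  -- environments are infinite, so a common period is an invariant, not a consequence of periodicity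
  CommonPeriod : Sᴾ.Env → (m : ℕ) → .{{NonZero m}} → Set
  CommonPeriod ρ m = ∀ y → HasPeriod (forget ρ y) m

  commonPeriod-update : ∀ {ρ} m .{{_ : NonZero m}} x (a : PerCarrier 𝔄) →
                        CommonPeriod ρ m → HasPeriod (proj₁ a) m → CommonPeriod (ρ Sᴾ.[ x ↦ a ]) m
  commonPeriod-update m x a per per-a y with y ≡ᵇ x
  ... | true  = per-a
  ... | false = per y

  commonPeriod-update-* : ∀ {ρ} m {{nzm : NonZero m}} x (a : PerCarrier 𝔄) →
                          CommonPeriod ρ m → let (_ , k , nzk , _) = a in
                          CommonPeriod (ρ Sᴾ.[ x ↦ a ]) (m * k) {{m*n≢0 m k {{nzm}} {{nzk}}}}
  commonPeriod-update-* m {{nzm}} x a@(_ , k , nzk , per-a) per =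
    commonPeriod-update (m * k) x a (λ y → hasPeriod-∣ m (m * k) (m∣m*n k) (per y))
                        (hasPeriod-∣ k (m * k) {{nzk}} (n∣m*n m) per-a)
    where instance _ = m*n≢0 m k {{nzm}} {{nzk}}

  module _ (m : ℕ) {{nzm : NonZero m}} where
    toℕ-mod : ∀ j → toℕ (j mod m) ≡ j % m
    toℕ-mod j = toℕ-fromℕ< (m%n<n j m)

    toℕ-mod-id : ∀ i → toℕ i mod m ≡ i
    toℕ-mod-id i = toℕ-injective (trans (toℕ-mod (toℕ i)) (m<n⇒m%n≡m (toℕ<n i)))

    mod-% : ∀ j → j mod m ≡ (j % m) mod m
    mod-% j = fromℕ<-cong _ _ (sym (m%n%n≡m%n j m)) (m%n<n j m) (m%n<n (j % m) m)

    extend-periodic : ∀ (b : Fin m → Carrier) → HasPeriod (λ j → b (j mod m)) m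
    extend-periodic b j = ≈.reflexive (cong b (mod-% j))

    extend : (Fin m → Carrier) → PerCarrier 𝔄
    extend b = (λ j → b (j mod m)) , m , nzm , extend-periodic b

    extendEnv : Sᵐ.Env m → Sᴾ.Env
    extendEnv σ y = extend (σ y)

    restrict : Sᴾ.Env → Sᵐ.Env m
    restrict ρ y i = proj₁ (ρ y) (toℕ i)

    private
      module R = Reindexing 𝔄 (_mod m) toℕ toℕ-mod-id

    -- forget (extendEnv σ) is definitionally the pullback of σ along _mod m
    extend-qf : ∀ {φ} → QuantifierFree φ → ∀ σ → Sᵐ.Sat m σ φ → Sᴾ.Sat (extendEnv σ) φ
    extend-qf q σ s =
      subst id (sym (Sat-forget-qf q (extendEnv σ))) (Equivalence.from (R.pullback-qf q σ) s)

    extend-existsQF : ∀ {φ} → ExistsQF φ → ∀ σ → Sᵐ.Sat m σ φ → Sᴾ.Sat (extendEnv σ) φ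
    extend-existsQF (eqf-qf q)         σ s       = extend-qf q σ s
    extend-existsQF (eqf-∃ {y} {φ} e) σ (b , s) =
      extend b , Iᴾ.Sat-cong (Iᴾ.≡⇒≈ᴱ (update-∘ extend σ y b)) φ (extend-existsQF e (Sᵐ._[_↦_] m σ y b) s)

    coordinate-mod : ∀ {ρ} → CommonPeriod ρ m → ∀ y j → proj₁ (ρ y) (toℕ (j mod m)) ≈ proj₁ (ρ y) j
    coordinate-mod {ρ} per y j = ≈.trans (≈.reflexive (cong (proj₁ (ρ y)) (toℕ-mod j))) (≈.sym (per y j))

    extend-restrict : ∀ {ρ} → CommonPeriod ρ m → Iᴾ._≈ᴱ_ (extendEnv (restrict ρ)) ρ
    extend-restrict {ρ} per y = coordinate-mod {ρ} per y

  slice : Sᴾ.Env → ℕ → S.Env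
  slice ρ = Power.coordinate 𝔄 ℕ (forget ρ)

  positiveHorn-transfer : ∀ {φ} → PositiveHorn φ → ∀ m {{_ : NonZero m}} ρ → CommonPeriod ρ m →
                 (∀ j → S.Sat (slice ρ j) φ) → Sᴾ.Sat ρ φ
  positiveHorn-transfer (ph-atomic at-⊥)          m ρ per G = G 0
  positiveHorn-transfer (ph-atomic (at-rel R ts)) m ρ per G =
    subst id (sym (Sat-forget-qf (qf-rel R ts) ρ))
             (Equivalence.from (Pᴺ.rel-coordinatewise (forget ρ) R ts) G)
  positiveHorn-transfer (ph-atomic (at-eq u t))   m ρ per G =
    subst id (sym (Sat-forget-qf (qf-eq u t) ρ))
             (Equivalence.from (Pᴺ.≐-coordinatewise (forget ρ) u t) G)
  positiveHorn-transfer (ph-∧ p q) m ρ per G =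
    positiveHorn-transfer p m ρ per (proj₁ ∘ G) , positiveHorn-transfer q m ρ per (proj₂ ∘ G)
  positiveHorn-transfer (ph-∀ {x} {φ} p) m {{nzm}} ρ per G a@(â , k , nzk , _) =
    positiveHorn-transfer p (m * k) {{m*n≢0 m k {{nzm}} {{nzk}}}} (ρ Sᴾ.[ x ↦ a ])
      (commonPeriod-update-* m x a per)
      (λ j → Iᴬ.Sat-cong (Iᴬ.≡⇒≈ᴱ (λ y → sym (update-∘ (λ v → proj₁ v j) ρ x a y))) φ (G j (â j)))
  -- the witness at coordinate j is the one chosen at coordinate j % m
  positiveHorn-transfer (ph-∃ {x} {φ} p) m ρ per G =
    b , positiveHorn-transfer p m (ρ Sᴾ.[ x ↦ b ]) (commonPeriod-update m x b per (extend-periodic m w))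
          (λ j → Iᴬ.Sat-cong (slices-agree j) φ (proj₂ (G (toℕ (j mod m)))))
    where
    w : Fin m → Carrier
    w i = proj₁ (G (toℕ i))

    b : PerCarrier 𝔄
    b = extend m w

    slices-agree : ∀ j → Iᴬ._≈ᴱ_ (slice ρ (toℕ (j mod m)) S.[ x ↦ w (j mod m) ]) (slice (ρ Sᴾ.[ x ↦ b ]) j)
    slices-agree j y with y ≡ᵇ x
    ... | true  = ≈.refl
    ... | false = coordinate-mod m {ρ} per y j

  forallExists-transfer : ∀ {φ} → ForallExists φ → ∀ m {{_ : NonZero m}} ρ → CommonPeriod ρ m →
                 (∀ n {{_ : NonZero n}} → Sᵐ.Sat n (restrict n ρ) φ) → Sᴾ.Sat ρ φ
  forallExists-transfer (fe-∃ {φ} e) m ρ per H =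
    Iᴾ.Sat-cong {extendEnv m (restrict m ρ)} {ρ} (extend-restrict m {ρ} per) φ
                (extend-existsQF m e (restrict m ρ) (H m))
  forallExists-transfer (fe-∀ {x} {φ} f) m {{nzm}} ρ per H a@(â , k , nzk , _) =
    forallExists-transfer f (m * k) {{m*n≢0 m k {{nzm}} {{nzk}}}} (ρ Sᴾ.[ x ↦ a ])
      (commonPeriod-update-* m x a per)
      (λ n → Iᵐ.Sat-cong n (Iᵐ.≡⇒≈ᴱ n (λ y → sym (update-∘ (λ v i → proj₁ v (toℕ i)) ρ x a y)))
                φ (H n (λ i → â (toℕ i))))

corollary4p8 : (L : Language) (𝔄 : Structure L) →
    ((φ : Syntax.Formula L) → Syntax.Sentence L φ → Syntax.PositiveHorn L φ →
       𝔄 ⊨ φ → periodicPower 𝔄 ⊨ φ)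
    ×
    ((φ : Syntax.Formula L) → Syntax.Sentence L φ → Syntax.ForallExists L φ →
       ((k : ℕ) → 1 ≤ k → (𝔄 ^ k) ⊨ φ) → periodicPower 𝔄 ⊨ φ)
corollary4p8 L 𝔄 =
  (λ φ _ p 𝔄⊨φ → positiveHorn-transfer p 1 const constant-periodic (λ _ → 𝔄⊨φ)) ,
  (λ φ _ f 𝔄ᵏ⊨φ → forallExists-transfer f 1 const constant-periodic (λ n → 𝔄ᵏ⊨φ n (>-nonZero⁻¹ n)))
  where
  open PeriodicPower 𝔄
  const : Semantics.Env (periodicPower 𝔄)
  const _ = Structure.element (periodicPower 𝔄)
  constant-periodic : CommonPeriod const 1
  constant-periodic _ _ = IsEquivalence.refl (Structure.isEquiv 𝔄)
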